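{- Let $a\ge 2$ be even and let $c$ be an integer with $0<c<\frac a2$. Then $U=\{(a,-a),(c,-c),(0,0)\}$ is unavoidable in $\mathcal{B}$.
   Context: The bicyclic inverse semigroup is $\mathcal{B}=\{(a,b)\in\mathbb{Z}\times\mathbb{Z}\mid a\ge 0,\ a+b\ge 0\}$ with multiplication $(a,b)(c,d)=(\max\{c+d,a\}-d,\ b+d)$. A subset $U\subseteq\mathcal{B}$ is avoidable if $\mathcal{B}$ can be partitioned into two sets $A$ and $B$ such that no element of $U$ is a product $st$ of two distinct elements $s\ne t$ both in $A$ or both in $B$; otherwise $U$ is unavoidable. -}

module Defs where

open import Data.Integer using (ℤ; +_; _+_; _-_; _≤_; _⊔_)
open import Data.Product using (_×_; _,_; Σ; ∃)
open import Data.Bool using (Bool)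
open import Relation.Binary.PropositionalEquality using (_≡_; _≢_)
open import Data.Sum using (_⊎_)

-- Elements are integer pairs; membership in the bicyclic inverse semigroup
-- B = {(a,b) | a ≥ 0, a + b ≥ 0}.
InB : ℤ × ℤ → Set
InB (a , b) = (+ 0 ≤ a) × (+ 0 ≤ a + b)

_·_ : ℤ × ℤ → ℤ × ℤ → ℤ × ℤ
(a , b) · (c , d) = (((c + d) ⊔ a) - d , b + d)

-- A 2-partition of B is given by a colouring χ (A = χ⁻¹ true, B = χ⁻¹ false);
-- values of χ outside B are irrelevant.
Unavoidable : (ℤ × ℤ → Set) → Set
Unavoidable U =
  (χ : ℤ × ℤ → Bool) →
  Σ (ℤ × ℤ) λ s → Σ (ℤ × ℤ) λ t →
    InB s × InB t × s ≢ t × χ s ≡ χ t × U (s · t)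

module Submission where

-- For n ∈ ℕ write  I n = (n , -n)  and  P m = (0 , m).  These
-- elements of the bicyclic semigroup multiply by the rules
--     I n · I m = I (n + m)          I (n + m) · P m = I n ,
-- so for c, m > 0 with c ≠ m the five distinct elements
--     I 0 ,  I c ,  I m ,  P m ,  I (c + m)
-- form a pentagon in which every pair of neighbours multiplies (in one of
-- the two orders) into  U = {I (c + m), I c, I 0}.  A pentagon is an odd
-- cycle, so every 2-colouring makes some pair of neighbours monochromatic,
-- and that pair witnesses the unavoidability of U.
--
-- The theorem is the instance
-- a = 2k = c + m with m = 2k ∸ c, which satisfies m ≠ 0 and m ≠ c because
-- 0 < c < k.

open import Defs
open import Data.Nat using (ℕ; _≤_; _<_; _*_)
open import Data.Integer using (ℤ; +_; -_)
open import Data.Product using (_×_; _,_)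
open import Data.Sum using (_⊎_)
open import Relation.Binary.PropositionalEquality using (_≡_)

open import Data.Nat as ℕ using (_∸_; z≤n)
import Data.Nat.Properties as ℕP
import Data.Integer as ℤ
import Data.Integer.Properties as ℤP
open import Data.Bool using (Bool; true; false)
open import Data.Sum using (inj₁; inj₂)
open import Data.Product using (proj₁; Σ)
open import Relation.Binary.PropositionalEquality
  using (_≢_; refl; sym; trans; cong; cong₂; subst; module ≡-Reasoning)

open ≡-Reasoning

I : ℕ → ℤ × ℤ
I n = (+ n , - (+ n))

P : ℕ → ℤ × ℤ
P m = (+ 0 , + m)

I∈B : ∀ n → InB (I n)
I∈B n = ℤ.+≤+ z≤n , subst (ℤ._≤_ (+ 0)) (sym (ℤP.+-inverseʳ (+ n))) (ℤ.+≤+ z≤n)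

P∈B : ∀ m → InB (P m)
P∈B m = ℤ.+≤+ z≤n , ℤ.+≤+ z≤n

neg-+ : ∀ n m → - (+ n) ℤ.+ - (+ m) ≡ - (+ (n ℕ.+ m))
neg-+ n m = sym (ℤP.neg-distrib-+ (+ n) (+ m))

I·I : ∀ n m → I n · I m ≡ I (n ℕ.+ m)
I·I n m = cong₂ _,_ first (neg-+ n m)
  where
  first : ((+ m ℤ.+ - (+ m)) ℤ.⊔ + n) ℤ.- - (+ m) ≡ + (n ℕ.+ m)
  first = begin
    ((+ m ℤ.+ - (+ m)) ℤ.⊔ + n) ℤ.- - (+ m) ≡⟨ cong (λ z → (z ℤ.⊔ + n) ℤ.- - (+ m)) (ℤP.+-inverseʳ (+ m)) ⟩
    + n ℤ.+ - - (+ m)                        ≡⟨ cong (ℤ._+_ (+ n)) (ℤP.neg-involutive (+ m)) ⟩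
    + (n ℕ.+ m)                              ∎

I·P : ∀ n m → I (n ℕ.+ m) · P m ≡ I n
I·P n m = cong₂ _,_ first second
  where
  m≤n+m : m ≤ n ℕ.+ m
  m≤n+m = ℕP.m≤n+m m n

  first : (+ m ℤ.⊔ + (n ℕ.+ m)) ℤ.- + m ≡ + n
  first = begin
    (+ m ℤ.⊔ + (n ℕ.+ m)) ℤ.- + m ≡⟨ cong (λ z → + z ℤ.- + m) (ℕP.m≤n⇒m⊔n≡n m≤n+m) ⟩
    + (n ℕ.+ m) ℤ.- + m           ≡⟨ ℤP.[+m]-[+n]≡m⊖n (n ℕ.+ m) m ⟩
    (n ℕ.+ m) ℤ.⊖ m               ≡⟨ ℤP.⊖-≥ m≤n+m ⟩
    + (n ℕ.+ m ∸ m)               ≡⟨ cong +_ (ℕP.m+n∸n≡m n m) ⟩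
    + n                           ∎

  second : - (+ (n ℕ.+ m)) ℤ.+ + m ≡ - (+ n)
  second = begin
    - (+ (n ℕ.+ m)) ℤ.+ + m ≡⟨ ℤP.-m+n≡n⊖m (n ℕ.+ m) m ⟩
    m ℤ.⊖ (n ℕ.+ m)         ≡⟨ ℤP.⊖-≤ m≤n+m ⟩
    - (+ (n ℕ.+ m ∸ m))     ≡⟨ cong (λ z → - (+ z)) (ℕP.m+n∸n≡m n m) ⟩
    - (+ n)                 ∎

I-injective : ∀ {n m} → n ≢ m → I n ≢ I m
I-injective n≢m eq = n≢m (ℤP.+-injective (cong proj₁ eq))

I≢P : ∀ {n m} → n ≢ 0 → I n ≢ P m
I≢P n≢0 eq = n≢0 (ℤP.+-injective (cong proj₁ eq))

BadPair : (ℤ × ℤ → Set) → ℤ × ℤ → ℤ × ℤ → Set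
BadPair U s t = InB s × InB t × s ≢ t × U (s · t)

Linked : (ℤ × ℤ → Set) → ℤ × ℤ → ℤ × ℤ → Set
Linked U s t = BadPair U s t ⊎ BadPair U t s

Witness : (ℤ × ℤ → Set) → (ℤ × ℤ → Bool) → Set
Witness U χ = Σ (ℤ × ℤ) λ s → Σ (ℤ × ℤ) λ t →
  InB s × InB t × s ≢ t × χ s ≡ χ t × U (s · t)

monochromatic : ∀ U {s t} (χ : ℤ × ℤ → Bool) → Linked U s t → χ s ≡ χ t → Witness U χ
monochromatic U {s} {t} χ (inj₁ (s∈B , t∈B , s≢t , st∈U)) same =
  s , t , s∈B , t∈B , s≢t , same , st∈U
monochromatic U {s} {t} χ (inj₂ (t∈B , s∈B , t≢s , ts∈U)) same =
  t , s , t∈B , s∈B , t≢s , sym same , ts∈U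

pentagon-monochromatic : (b₀ b₁ b₂ b₃ b₄ : Bool) →
  b₀ ≡ b₁ ⊎ b₁ ≡ b₂ ⊎ b₂ ≡ b₃ ⊎ b₃ ≡ b₄ ⊎ b₄ ≡ b₀
pentagon-monochromatic true  true  _     _     _     = inj₁ refl
pentagon-monochromatic false false _     _     _     = inj₁ refl
pentagon-monochromatic true  false false _     _     = inj₂ (inj₁ refl)
pentagon-monochromatic false true  true  _     _     = inj₂ (inj₁ refl)
pentagon-monochromatic true  false true  true  _     = inj₂ (inj₂ (inj₁ refl))
pentagon-monochromatic false true  false false _     = inj₂ (inj₂ (inj₁ refl))
pentagon-monochromatic true  false true  false false = inj₂ (inj₂ (inj₂ (inj₁ refl)))
pentagon-monochromatic false true  false true  true  = inj₂ (inj₂ (inj₂ (inj₁ refl)))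
pentagon-monochromatic true  false true  false true  = inj₂ (inj₂ (inj₂ (inj₂ refl)))
pentagon-monochromatic false true  false true  false = inj₂ (inj₂ (inj₂ (inj₂ refl)))

pentagon-unavoidable : ∀ U x₀ x₁ x₂ x₃ x₄ →
  Linked U x₀ x₁ → Linked U x₁ x₂ → Linked U x₂ x₃ → Linked U x₃ x₄ → Linked U x₄ x₀ →
  Unavoidable U
pentagon-unavoidable U x₀ x₁ x₂ x₃ x₄ l₀₁ l₁₂ l₂₃ l₃₄ l₄₀ χ
  with pentagon-monochromatic (χ x₀) (χ x₁) (χ x₂) (χ x₃) (χ x₄)
... | inj₁ same                          = monochromatic U χ l₀₁ same
... | inj₂ (inj₁ same)                   = monochromatic U χ l₁₂ same
... | inj₂ (inj₂ (inj₁ same))            = monochromatic U χ l₂₃ same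
... | inj₂ (inj₂ (inj₂ (inj₁ same)))     = monochromatic U χ l₃₄ same
... | inj₂ (inj₂ (inj₂ (inj₂ same)))     = monochromatic U χ l₄₀ same

U₃ : ℕ → ℕ → ℤ × ℤ → Set
U₃ a c x = x ≡ I a ⊎ x ≡ I c ⊎ x ≡ I 0

U₃-unavoidable : ∀ c m → c ≢ 0 → m ≢ 0 → c ≢ m → Unavoidable (U₃ (c ℕ.+ m) c)
U₃-unavoidable c m c≢0 m≢0 c≢m =
  pentagon-unavoidable (U₃ (c ℕ.+ m) c) (I 0) (I c) (I m) (P m) (I (c ℕ.+ m))
    (inj₁ (I∈B 0 , I∈B c , I-injective (λ 0≡c → c≢0 (sym 0≡c)) ,
           inj₂ (inj₁ (I·I 0 c))))
    (inj₁ (I∈B c , I∈B m , I-injective c≢m , inj₁ (I·I c m)))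
    (inj₁ (I∈B m , P∈B m , I≢P m≢0 , inj₂ (inj₂ (I·P 0 m))))
    (inj₂ (I∈B (c ℕ.+ m) , P∈B m , I≢P c+m≢0 , inj₂ (inj₁ (I·P c m))))
    (inj₁ (I∈B (c ℕ.+ m) , I∈B 0 , I-injective c+m≢0 ,
           inj₁ (trans (I·I (c ℕ.+ m) 0) (cong I (ℕP.+-identityʳ (c ℕ.+ m))))))
  where
  c+m≢0 : c ℕ.+ m ≢ 0
  c+m≢0 c+m≡0 = m≢0 (ℕP.m+n≡0⇒n≡0 c c+m≡0)

mainTheorem7 : (k c : ℕ) → 1 ≤ k → 0 < c → c < k →
    Unavoidable (λ x → (x ≡ (+ (2 * k) , - (+ (2 * k)))) ⊎ (x ≡ (+ c , - (+ c))) ⊎ (x ≡ (+ 0 , + 0)))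
mainTheorem7 k c _ 0<c c<k =
  subst (λ a → Unavoidable (U₃ a c)) c+m≡2k
    (U₃-unavoidable c m (ℕP.m<n⇒n≢0 0<c) m≢0 c≢m)
  where
  m : ℕ
  m = 2 * k ∸ c

  c<2k : c < 2 * k
  c<2k = ℕP.<-≤-trans c<k (ℕP.m≤m+n k (k ℕ.+ 0))

  c+m≡2k : c ℕ.+ m ≡ 2 * k
  c+m≡2k = ℕP.m+[n∸m]≡n (ℕP.<⇒≤ c<2k)

  -- m = 0 would force c = 2k.
  m≢0 : m ≢ 0
  m≢0 m≡0 = ℕP.<⇒≢ c<2k (trans (sym (ℕP.+-identityʳ c)) (subst (λ z → c ℕ.+ z ≡ 2 * k) m≡0 c+m≡2k))

  -- m = c would force 2c = 2k, whereas c + c < k + k.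
  c≢m : c ≢ m
  c≢m c≡m = ℕP.<⇒≢ (ℕP.+-mono-< c<k c<k)
    (trans (subst (λ z → c ℕ.+ z ≡ 2 * k) (sym c≡m) c+m≡2k) (cong (k ℕ.+_) (ℕP.+-identityʳ k)))
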